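{- Let $k$ be a positive integer and $S=\langle 4k+5,4k+7,4k+11,4k+13\rangle$. Then (1) $\mathrm{PF}(S)=\{4k+9,\ 4k^2+13k+2,\ 4k^2+13k+4,\ 4k^2+13k+6,\ 4k^2+13k+8\}$; (2) $\mathrm{F}(S)=4k^2+13k+8$; (3) $\mathrm{g}(S)=2k^2+8k+7$; (4) $\mathrm{t}(S)=5$.
   Context: $\mathbb{N}=\{0,1,2,\dots\}$. For $X\subseteq\mathbb{N}$, $\langle X\rangle$ is the submonoid of $(\mathbb{N},+)$ generated by $X$; here it is a numerical semigroup. $\mathrm{F}(S)$ is the largest integer not in $S$, $\mathrm{g}(S)=|\mathbb{N}\setminus S|$, $\mathrm{PF}(S)$ is the set of integers $x\notin S$ with $x+s\in S$ for all $s\in S\setminus\{0\}$, and $\mathrm{t}(S)=|\mathrm{PF}(S)|$. -}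

module Defs where

open import Data.Nat as ℕ using (ℕ; _*_)
open import Data.Integer as ℤ using (ℤ; +_)
open import Data.List using (List; length; zipWith)
open import Data.Nat.ListAction using (sum)
open import Data.List.Membership.Propositional using (_∈_)
open import Data.List.Relation.Unary.Unique.Propositional using (Unique)
open import Data.Product using (Σ; ∃; _×_)
open import Relation.Binary.PropositionalEquality using (_≡_; _≢_)
open import Relation.Nullary using (¬_)
open import Function.Bundles using (_⇔_)

_∈⟨_⟩ : ℕ → List ℕ → Set
n ∈⟨ gens ⟩ = Σ (List ℕ) λ cs → (length cs ≡ length gens) × (sum (zipWith _*_ cs gens) ≡ n)

_∈ℤ⟨_⟩ : ℤ → List ℕ → Set
x ∈ℤ⟨ gens ⟩ = Σ ℕ λ n → (x ≡ + n) × (n ∈⟨ gens ⟩)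

IsPF : List ℕ → ℤ → Set
IsPF gens x = ¬ (x ∈ℤ⟨ gens ⟩) × (∀ (s : ℕ) → s ∈⟨ gens ⟩ → s ≢ 0 → (x ℤ.+ + s) ∈ℤ⟨ gens ⟩)

IsFrobenius : List ℕ → ℤ → Set
IsFrobenius gens f = ¬ (f ∈ℤ⟨ gens ⟩) × (∀ (x : ℤ) → ¬ (x ∈ℤ⟨ gens ⟩) → x ℤ.≤ f)

IsGenus : List ℕ → ℕ → Set
IsGenus gens g = Σ (List ℕ) λ L → Unique L × (∀ n → (n ∈ L) ⇔ (¬ (n ∈⟨ gens ⟩))) × (length L ≡ g)

IsType : List ℕ → ℕ → Set
IsType gens t = Σ (List ℤ) λ L → Unique L × (∀ x → (x ∈ L) ⇔ IsPF gens x) × (length L ≡ t)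

{-# OPTIONS --safe #-}
module Submission where

-- Write m = 4k + 5. The generators are m + 2δ with δ ∈ {0, 1, 3, 4}, so a sum of n of them is
-- n·m + 2j where j is a sum of n steps δ: every 0 ≤ j ≤ 4n occurs once n ≥ 2, while for n = 1 the
-- value j = 2 is missing. Hence S consists of the n·m + 2j with j ≤ 4n, except m + 4.
-- Since m is odd, every natural number is either odd and below m, or i·m + 2j with j < m, and two
-- such forms with j, j′ < m and i < i′ never agree (parity if i′ = i + 1, size otherwise). So the
-- gaps are the odd numbers below m, the number m + 4, and the "rows" i·m + 2j with 4i < j ≤ 4k + 4
-- for 0 ≤ i ≤ k. Counting gives g(S) = (2k + 2) + 1 + 2(k + 1)(k + 2), and the largest gap is the
-- end of row k. Adding m or m + 8 sends an odd gap or a gap of row i < k to another gap, so these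
-- are not pseudo-Frobenius; m + 4 is, since (m + 4) + (n·m + 2j) = (n + 1)·m + 2(j + 2), and so is
-- row k, since adding any nonzero element (≥ m) to it exceeds the Frobenius number.

open import Defs
open import Data.Nat using (ℕ; zero; suc; _+_; _*_; _≤_; _<_; z≤n; s≤s; _≤?_; _≟_; NonZero; ≢-nonZero)
open import Data.Nat.Properties
open import Data.Nat.DivMod using (_/_; _%_; m≡m%n+[m/n]*n; m%n<n)
open import Data.Nat.Tactic.RingSolver using (solve-∀)
open import Data.Integer as ℤ using (ℤ; +_; -[1+_])
import Data.Integer.Properties as ℤP
open import Data.List using (List; []; _∷_; _++_; map; applyUpTo; length)
open import Data.List.Properties using (length-++; length-applyUpTo)
open import Data.List.Membership.Propositional using (_∈_)
open import Data.List.Membership.Propositional.Properties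
  using (∈-map⁺; ∈-map⁻; ∈-++⁺ˡ; ∈-++⁺ʳ; ∈-++⁻; ∈-applyUpTo⁺; ∈-applyUpTo⁻)
open import Data.List.Relation.Unary.Any using (here; there)
open import Data.List.Relation.Unary.All as All using (All; []; _∷_)
open import Data.List.Relation.Unary.AllPairs using ([]; _∷_)
open import Data.List.Relation.Unary.Unique.Propositional using (Unique)
import Data.List.Relation.Unary.Unique.Propositional.Properties as Unique
open import Data.List.Relation.Binary.Disjoint.Propositional using (Disjoint)
open import Data.Product using (∃; ∃₂; _×_; _,_; proj₁; proj₂)
open import Data.Sum using (_⊎_; inj₁; inj₂)
open import Data.Empty using (⊥-elim)
open import Relation.Nullary using (¬_; yes; no)
open import Relation.Binary.PropositionalEquality
open import Function using (_∘_)
open import Function.Bundles using (_⇔_; mk⇔; Equivalence)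
import Function.Properties.Equivalence as ⇔

open Equivalence using (to; from)

-- Submonoids of (ℕ, +)

0∈⟨⟩ : ∀ gs → 0 ∈⟨ gs ⟩
0∈⟨⟩ []       = [] , refl , refl
0∈⟨⟩ (g ∷ gs) with cs , len , eq ← 0∈⟨⟩ gs = 0 ∷ cs , cong suc len , eq

∈⟨⟩-gen : ∀ {g gs} → g ∈ gs → g ∈⟨ gs ⟩
∈⟨⟩-gen {g} {_ ∷ gs} (here refl) with cs , len , eq ← 0∈⟨⟩ gs =
  1 ∷ cs , cong suc len , trans (cong (_+_ (1 * g)) eq) (trans (+-identityʳ (1 * g)) (*-identityˡ g))
∈⟨⟩-gen (there g∈gs) with cs , len , eq ← ∈⟨⟩-gen g∈gs = 0 ∷ cs , cong suc len , eq

∈⟨⟩-+ : ∀ {gs x y} → x ∈⟨ gs ⟩ → y ∈⟨ gs ⟩ → (x + y) ∈⟨ gs ⟩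
∈⟨⟩-+ {[]}    ([] , _ , refl)     ([] , _ , refl)      = [] , refl , refl
∈⟨⟩-+ {[]}    (_ ∷ _ , () , _)    _
∈⟨⟩-+ {[]}    ([] , _ , _)        (_ ∷ _ , () , _)
∈⟨⟩-+ {_ ∷ _} ([] , () , _)       _
∈⟨⟩-+ {_ ∷ _} (_ ∷ _ , _ , _)     ([] , () , _)
∈⟨⟩-+ {g ∷ gs} (c ∷ cs , len , refl) (d ∷ ds , len′ , refl)
  with es , len″ , eq ← ∈⟨⟩-+ {gs} (cs , suc-injective len , refl) (ds , suc-injective len′ , refl) =
  c + d ∷ es , cong suc len″ , trans (cong (_+_ ((c + d) * g)) eq) (interchange c d g _ _)
  where
  interchange : ∀ c d g a b → (c + d) * g + (a + b) ≡ (c * g + a) + (d * g + b)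
  interchange = solve-∀

⟨⟩-induction : (P : ℕ → Set) → P 0 → (∀ {x y} → P x → P y → P (x + y)) →
               ∀ {gs} → All P gs → ∀ {x} → x ∈⟨ gs ⟩ → P x
⟨⟩-induction P P0 P+ []          ([] , _ , refl)       = P0
⟨⟩-induction P P0 P+ []          (_ ∷ _ , () , _)
⟨⟩-induction P P0 P+ (_ ∷ _)     ([] , () , _)
⟨⟩-induction P P0 P+ {g ∷ _} (Pg ∷ Pgs) (c ∷ cs , len , refl) =
  P+ (multiple c) (⟨⟩-induction P P0 P+ Pgs (cs , suc-injective len , refl))
  where
  multiple : ∀ c → P (c * g)
  multiple zero    = P0
  multiple (suc c) = P+ Pg (multiple c)

+∈ℤ⟨⟩⇔∈⟨⟩ : ∀ {gs n} → (+ n) ∈ℤ⟨ gs ⟩ ⇔ n ∈⟨ gs ⟩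
+∈ℤ⟨⟩⇔∈⟨⟩ = mk⇔ (λ { (_ , refl , n∈) → n∈ }) (λ n∈ → _ , refl , n∈)

IsPF[+x]⇔ : ∀ {gs x} →
  IsPF gs (+ x) ⇔ (¬ x ∈⟨ gs ⟩ × (∀ s → s ∈⟨ gs ⟩ → s ≢ 0 → (x + s) ∈⟨ gs ⟩))
IsPF[+x]⇔ = mk⇔
  (λ (x∉ , closed) → x∉ ∘ from +∈ℤ⟨⟩⇔∈⟨⟩ , λ s s∈ s≢0 → to +∈ℤ⟨⟩⇔∈⟨⟩ (closed s s∈ s≢0))
  (λ (x∉ , closed) → x∉ ∘ to +∈ℤ⟨⟩⇔∈⟨⟩ , λ s s∈ s≢0 → from +∈ℤ⟨⟩⇔∈⟨⟩ (closed s s∈ s≢0))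

-[1+p]+g≡+n⇒n+1+p≡g : ∀ {p g n} → -[1+ p ] ℤ.+ + g ≡ + n → n + suc p ≡ g
-[1+p]+g≡+n⇒n+1+p≡g {p} {g} {n} eq = ℤP.+-injective (begin
  + n ℤ.+ + suc p                 ≡⟨ cong (ℤ._+ + suc p) eq ⟨
  (-[1+ p ] ℤ.+ + g) ℤ.+ + suc p  ≡⟨ cong (ℤ._+ + suc p) (ℤP.+-comm -[1+ p ] (+ g)) ⟩
  (+ g ℤ.+ -[1+ p ]) ℤ.+ + suc p  ≡⟨ ℤP.+-assoc (+ g) -[1+ p ] (+ suc p) ⟩
  + g ℤ.+ (-[1+ p ] ℤ.+ + suc p)  ≡⟨ cong (ℤ._+_ (+ g)) (ℤP.+-inverseˡ (+ suc p)) ⟩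
  + g ℤ.+ + 0                     ≡⟨ ℤP.+-identityʳ (+ g) ⟩
  + g                             ∎)
  where open ≡-Reasoning

-- The semigroup ⟨m, m + 2, m + 6, m + 8⟩

steps : List ℕ
steps = 0 ∷ 1 ∷ 3 ∷ 4 ∷ []

gens : ℕ → List ℕ
gens m = map (λ δ → m + 2 * δ) steps

∈steps⇔ : ∀ {δ} → δ ∈ steps ⇔ (δ ≤ 4 × δ ≢ 2)
∈steps⇔ = mk⇔ bounds fromBounds
  where
  bounds : ∀ {δ} → δ ∈ steps → δ ≤ 4 × δ ≢ 2
  bounds (here refl)                         = z≤n , λ ()
  bounds (there (here refl))                 = s≤s z≤n , λ ()
  bounds (there (there (here refl)))         = s≤s (s≤s (s≤s z≤n)) , λ ()
  bounds (there (there (there (here refl)))) = ≤-refl , λ ()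
  fromBounds : ∀ {δ} → δ ≤ 4 × δ ≢ 2 → δ ∈ steps
  fromBounds {0} _           = here refl
  fromBounds {1} _           = there (here refl)
  fromBounds {2} (_ , 2≢2)   = ⊥-elim (2≢2 refl)
  fromBounds {3} _           = there (there (here refl))
  fromBounds {4} _           = there (there (there (here refl)))
  fromBounds {suc (suc (suc (suc (suc _))))} (s≤s (s≤s (s≤s (s≤s ()))) , _)

gen : ∀ {m δ} → δ ∈ steps → (m + 2 * δ) ∈⟨ gens m ⟩
gen {m} δ∈ = ∈⟨⟩-gen (∈-map⁺ (λ δ → m + 2 * δ) δ∈)

gen+gen : ∀ {m a b} → a ∈ steps → b ∈ steps → (2 * m + 2 * (a + b)) ∈⟨ gens m ⟩
gen+gen {m} {a} {b} a∈ b∈ = subst (_∈⟨ gens m ⟩) (regroup m a b) (∈⟨⟩-+ (gen a∈) (gen b∈))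
  where
  regroup : ∀ m a b → (m + 2 * a) + (m + 2 * b) ≡ 2 * m + 2 * (a + b)
  regroup = solve-∀

-- Every 0 ≤ j ≤ 8 is a sum of two elements of {0, 1, 3, 4}.
level₂ : ∀ {m j} → j ≤ 8 → (2 * m + 2 * j) ∈⟨ gens m ⟩
level₂ {j = 0} _ = gen+gen (here refl) (here refl)
level₂ {j = 1} _ = gen+gen (here refl) (there (here refl))
level₂ {j = 2} _ = gen+gen (there (here refl)) (there (here refl))
level₂ {j = 3} _ = gen+gen (here refl) (there (there (here refl)))
level₂ {j = 4} _ = gen+gen (here refl) (there (there (there (here refl))))
level₂ {j = 5} _ = gen+gen (there (here refl)) (there (there (there (here refl))))
level₂ {j = 6} _ = gen+gen (there (there (here refl))) (there (there (here refl)))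
level₂ {j = 7} _ = gen+gen (there (there (here refl))) (there (there (there (here refl))))
level₂ {j = 8} _ = gen+gen (there (there (there (here refl)))) (there (there (there (here refl))))
level₂ {j = suc (suc (suc (suc (suc (suc (suc (suc (suc _))))))))}
  (s≤s (s≤s (s≤s (s≤s (s≤s (s≤s (s≤s (s≤s ()))))))))

level : ∀ {m} n {j} → j ≤ 4 * (2 + n) → ((2 + n) * m + 2 * j) ∈⟨ gens m ⟩
level zero j≤8 = level₂ j≤8
level {m} (suc n) {j} j≤ with j ≤? 4 * (2 + n)
... | yes j≤′ = subst (_∈⟨ gens m ⟩) (add-m m n j) (∈⟨⟩-+ (level n j≤′) (gen (here refl)))
  where
  add-m : ∀ m n j → (2 + n) * m + 2 * j + (m + 2 * 0) ≡ (3 + n) * m + 2 * j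
  add-m = solve-∀
... | no j≰ with j′ , refl ← m≤n⇒∃[o]m+o≡n (≤-trans (m≤m*n 4 (2 + n)) (<⇒≤ (≰⇒> j≰))) =
  subst (_∈⟨ gens m ⟩) (add-m+8 m n j′)
    (∈⟨⟩-+ (level n (+-cancelˡ-≤ 4 _ _ (subst (4 + j′ ≤_) (*-suc 4 (2 + n)) j≤)))
           (gen (there (there (there (here refl))))))
  where
  add-m+8 : ∀ m n j′ → (2 + n) * m + 2 * j′ + (m + 2 * 4) ≡ (3 + n) * m + 2 * (4 + j′)
  add-m+8 = solve-∀

record InS (m x : ℕ) : Set where
  constructor inS
  field
    n j     : ℕ
    x≡nm+2j : x ≡ n * m + 2 * j
    j≤4n    : j ≤ 4 * n
    x≢m+4   : x ≢ m + 4

InS⇒∈⟨gens⟩ : ∀ {m x} → InS m x → x ∈⟨ gens m ⟩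
InS⇒∈⟨gens⟩ {m} (inS 0 0 refl _ _) = 0∈⟨⟩ (gens m)
InS⇒∈⟨gens⟩ (inS 0 (suc _) _ () _)
InS⇒∈⟨gens⟩ {m} (inS 1 j refl j≤4 x≢m+4) =
  subst (_∈⟨ gens m ⟩) (cong (λ z → z + 2 * j) (sym (*-identityˡ m)))
    (gen (from ∈steps⇔ (j≤4 , λ { refl → x≢m+4 (cong (λ z → z + 4) (*-identityˡ m)) })))
InS⇒∈⟨gens⟩ (inS (suc (suc n)) j refl j≤ _) = level n j≤

m≤[1+n]*m+k : ∀ m n k → m ≤ suc n * m + k
m≤[1+n]*m+k m n k = ≤-trans (m≤m+n m (n * m)) (m≤m+n (suc n * m) k)

InS⇒≡0⊎≥m : ∀ {m x} → InS m x → x ≡ 0 ⊎ m ≤ x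
InS⇒≡0⊎≥m (inS 0 0 x≡0 _ _)               = inj₁ x≡0
InS⇒≡0⊎≥m (inS 0 (suc _) _ () _)
InS⇒≡0⊎≥m {m} (inS (suc n) j x≡ _ _)     = inj₂ (subst (m ≤_) (sym x≡) (m≤[1+n]*m+k m n (2 * j)))

InS-0 : ∀ {m} → InS m 0
InS-0 {m} = inS 0 0 refl z≤n (λ 0≡m+4 → m+1+n≢0 m (sym 0≡m+4))

InS-step : ∀ {m δ} → δ ∈ steps → InS m (m + 2 * δ)
InS-step {m} {δ} δ∈ with δ≤4 , δ≢2 ← to ∈steps⇔ δ∈ =
  inS 1 δ (cong (λ z → z + 2 * δ) (sym (*-identityˡ m))) δ≤4
    (δ≢2 ∘ *-cancelˡ-≡ δ 2 2 ∘ +-cancelˡ-≡ m (2 * δ) 4)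

-- Two nonzero elements are ≥ m, so their sum exceeds m + 4.
InS-+ : ∀ {m x y} → 5 ≤ m → InS m x → InS m y → InS m (x + y)
InS-+ {m} {x} {y} 5≤m X@(inS n j x≡ j≤ x≢) Y@(inS n′ j′ y≡ j′≤ y≢) =
  inS (n + n′) (j + j′) (trans (cong₂ _+_ x≡ y≡) (regroup n n′ m j j′))
    (≤-trans (+-mono-≤ j≤ j′≤) (≤-reflexive (sym (*-distribˡ-+ 4 n n′))))
    (sum≢ (InS⇒≡0⊎≥m X) (InS⇒≡0⊎≥m Y))
  where
  regroup : ∀ n n′ m j j′ → (n * m + 2 * j) + (n′ * m + 2 * j′) ≡ (n + n′) * m + 2 * (j + j′)
  regroup = solve-∀
  sum≢ : x ≡ 0 ⊎ m ≤ x → y ≡ 0 ⊎ m ≤ y → x + y ≢ m + 4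
  sum≢ (inj₁ x≡0) _          eq = y≢ (trans (cong (λ z → z + y) (sym x≡0)) eq)
  sum≢ (inj₂ _)   (inj₁ y≡0) eq = x≢ (trans (trans (sym (+-identityʳ x)) (cong (_+_ x) (sym y≡0))) eq)
  sum≢ (inj₂ m≤x) (inj₂ m≤y) eq = <-irrefl (sym eq) (<-≤-trans (+-monoʳ-< m 5≤m) (+-mono-≤ m≤x m≤y))

∈⟨gens⟩⇔InS : ∀ {m x} → 5 ≤ m → x ∈⟨ gens m ⟩ ⇔ InS m x
∈⟨gens⟩⇔InS {m} 5≤m = mk⇔
  (⟨⟩-induction (InS m) InS-0 (InS-+ 5≤m)
    (InS-step (here refl) ∷ InS-step (there (here refl)) ∷ InS-step (there (there (here refl)))
      ∷ InS-step (there (there (there (here refl)))) ∷ []))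
  InS⇒∈⟨gens⟩

m+4+InS : ∀ {m s} → InS m s → s ≢ 0 → InS m (m + 4 + s)
m+4+InS {m} {s} (inS n j s≡ j≤4n _) s≢0 =
  inS (suc n) (2 + j) (trans (cong (_+_ (m + 4)) s≡) (regroup m n j))
    (≤-trans (+-mono-≤ (s≤s (s≤s (z≤n {2}))) j≤4n) (≤-reflexive (sym (*-suc 4 n))))
    (λ eq → s≢0 (+-cancelˡ-≡ (m + 4) s 0 (trans eq (sym (+-identityʳ (m + 4))))))
  where
  regroup : ∀ m n j → m + 4 + (n * m + 2 * j) ≡ suc n * m + 2 * (2 + j)
  regroup = solve-∀

-- Gaps

data Gap (m x : ℕ) : Set where
  below       : ∀ s → x ≡ suc (2 * s) → x < m → Gap m x
  exceptional : x ≡ m + 4 → Gap m x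
  block       : ∀ i j → 4 * i < j → j < m → x ≡ i * m + 2 * j → Gap m x

data Canonical (m x : ℕ) : Set where
  below : ∀ s → x ≡ suc (2 * s) → x < m → Canonical m x
  form  : ∀ i j → j < m → x ≡ i * m + 2 * j → Canonical m x

even⊎odd : ∀ n → (∃ λ s → n ≡ 2 * s) ⊎ (∃ λ s → n ≡ suc (2 * s))
even⊎odd zero = inj₁ (0 , refl)
even⊎odd (suc n) with even⊎odd n
... | inj₁ (s , refl) = inj₂ (s , refl)
... | inj₂ (s , refl) = inj₁ (suc s , cong suc (sym (+-suc s (s + 0))))

[1+i]*m+k≡i*m+[m+k] : ∀ i m k → suc i * m + k ≡ i * m + (m + k)
[1+i]*m+k≡i*m+[m+k] i m k = trans (cong (λ z → z + k) (+-comm m (i * m))) (+-assoc (i * m) m k)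

i*m+2j<[2+i]*m : ∀ {m j} i → j < m → i * m + 2 * j < (2 + i) * m
i*m+2j<[2+i]*m {m} i j<m =
  <-≤-trans (+-monoʳ-< (i * m) (*-monoʳ-< 2 j<m)) (≤-reflexive (regroup i m))
  where
  regroup : ∀ i m → i * m + 2 * m ≡ (2 + i) * m
  regroup = solve-∀

odd<m⇒≢nm+2j : ∀ {m s} n j → suc (2 * s) < m → suc (2 * s) ≢ n * m + 2 * j
odd<m⇒≢nm+2j {s = s} zero j _ eq = even≢odd j s (sym eq)
odd<m⇒≢nm+2j {m} {s} (suc n) j lt eq = <⇒≱ lt (subst (m ≤_) (sym eq) (m≤[1+n]*m+k m n (2 * j)))

rowEntry : ℕ → ℕ → ℕ → ℕ
rowEntry m i u = i * m + 2 * suc (4 * i + u)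

row : ℕ → ℕ → ℕ → List ℕ
row m i w = applyUpTo (rowEntry m i) w

rows : ℕ → ℕ → ℕ → List ℕ
rows m i zero    = []
rows m i (suc c) = row m i (4 * suc c) ++ rows m (suc i) c

∈row⁻ : ∀ m i w {x} → x ∈ row m i w → ∃ λ j → 4 * i < j × j ≤ 4 * i + w × x ≡ i * m + 2 * j
∈row⁻ m i w x∈ with u , u<w , refl ← ∈-applyUpTo⁻ (rowEntry m i) x∈ =
  suc (4 * i + u) , s≤s (m≤m+n (4 * i) u) ,
  subst (_≤ 4 * i + w) (+-suc (4 * i) u) (+-monoʳ-≤ (4 * i) u<w) , refl

∈row⁺ : ∀ m i w {j} → 4 * i < j → j ≤ 4 * i + w → (i * m + 2 * j) ∈ row m i w
∈row⁺ m i w 4i<j j≤ with u , refl ← m≤n⇒∃[o]m+o≡n 4i<j =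
  ∈-applyUpTo⁺ (rowEntry m i)
    (+-cancelˡ-≤ (4 * i) (suc u) w (subst (_≤ 4 * i + w) (sym (+-suc (4 * i) u)) j≤))

∈rows⁻ : ∀ m i c {x} → x ∈ rows m i c →
         ∃₂ λ i′ j → i ≤ i′ × 4 * i′ < j × j ≤ 4 * (i + c) × x ≡ i′ * m + 2 * j
∈rows⁻ m i (suc c) x∈ with ∈-++⁻ (row m i (4 * suc c)) x∈
... | inj₁ x∈row with j , 4i<j , j≤ , x≡ ← ∈row⁻ m i (4 * suc c) x∈row =
  i , j , ≤-refl , 4i<j , subst (j ≤_) (sym (*-distribˡ-+ 4 i (suc c))) j≤ , x≡
... | inj₂ x∈rows with i′ , j , i<i′ , 4i′<j , j≤ , x≡ ← ∈rows⁻ m (suc i) c x∈rows =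
  i′ , j , <⇒≤ i<i′ , 4i′<j , subst (λ z → j ≤ 4 * z) (sym (+-suc i c)) j≤ , x≡

∈rows⁺ : ∀ m i c i′ {j} → i ≤ i′ → 4 * i′ < j → j ≤ 4 * (i + c) → (i′ * m + 2 * j) ∈ rows m i c
∈rows⁺ m i zero i′ {j} i≤i′ 4i′<j j≤ =
  ⊥-elim (<⇒≱ (≤-<-trans (*-monoʳ-≤ 4 i≤i′) 4i′<j) (subst (λ z → j ≤ 4 * z) (+-identityʳ i) j≤))
∈rows⁺ m i (suc c) i′ {j} i≤i′ 4i′<j j≤ with m≤n⇒m<n∨m≡n i≤i′
... | inj₂ refl = ∈-++⁺ˡ (∈row⁺ m i (4 * suc c) 4i′<j (subst (j ≤_) (*-distribˡ-+ 4 i (suc c)) j≤))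
... | inj₁ i<i′ = ∈-++⁺ʳ (row m i (4 * suc c))
                    (∈rows⁺ m (suc i) c i′ i<i′ 4i′<j (subst (λ z → j ≤ 4 * z) (+-suc i c) j≤))

length-rows : ∀ m i c → length (rows m i c) ≡ 2 * c * suc c
length-rows m i zero    = refl
length-rows m i (suc c) = begin
  length (row m i (4 * suc c) ++ rows m (suc i) c)           ≡⟨ length-++ (row m i (4 * suc c)) ⟩
  length (row m i (4 * suc c)) + length (rows m (suc i) c)   ≡⟨ cong₂ _+_ (length-applyUpTo (rowEntry m i) (4 * suc c))
                                                                          (length-rows m (suc i) c) ⟩
  4 * suc c + 2 * c * suc c                                   ≡⟨ regroup c ⟩
  2 * suc c * suc (suc c)                                     ∎
  where
  open ≡-Reasoning
  regroup : ∀ c → 4 * suc c + 2 * c * suc c ≡ 2 * suc c * suc (suc c)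
  regroup = solve-∀

row-unique : ∀ m i w → Unique (row m i w)
row-unique m i w = Unique.applyUpTo⁺₁ (rowEntry m i) w
  (λ u<u′ _ → <⇒≢ (+-monoʳ-< (i * m) (*-monoʳ-< 2 (s≤s (+-monoʳ-< (4 * i) u<u′)))))

module OddMultiplicity {m h : ℕ} (m≡1+2h : m ≡ suc (2 * h)) where

  even≢m+even : ∀ j j′ → 2 * j ≢ m + 2 * j′
  even≢m+even j j′ eq = even≢odd j (h + j′) (begin
    2 * j                   ≡⟨ eq ⟩
    m + 2 * j′              ≡⟨ cong (λ z → z + 2 * j′) m≡1+2h ⟩
    suc (2 * h + 2 * j′)    ≡⟨ cong suc (*-distribˡ-+ 2 h j′) ⟨
    suc (2 * (h + j′))      ∎)
    where open ≡-Reasoning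

  -- i′ = i + 1 is ruled out by parity (m is odd), i′ ≥ i + 2 by size (2 j < 2 m).
  canonical-≢ : ∀ {i i′ j} j′ → j < m → i < i′ → i * m + 2 * j ≢ i′ * m + 2 * j′
  canonical-≢ {i} {i′} {j} j′ j<m i<i′ eq with m≤n⇒m<n∨m≡n i<i′
  ... | inj₂ refl = even≢m+even j j′
                      (+-cancelˡ-≡ (i * m) _ _ (trans eq ([1+i]*m+k≡i*m+[m+k] i m (2 * j′))))
  ... | inj₁ 2+i≤i′ = <-irrefl eq (<-≤-trans (i*m+2j<[2+i]*m i j<m)
                        (≤-trans (*-monoˡ-≤ m 2+i≤i′) (m≤m+n (i′ * m) (2 * j′))))

  block≢ : ∀ i j n j′ → 4 * i < j → j < m → j′ ≤ 4 * n → i * m + 2 * j ≢ n * m + 2 * j′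
  block≢ i j n j′ 4i<j j<m j′≤4n eq with n ≤? i
  ... | no n≰i  = canonical-≢ j′ j<m (≰⇒> n≰i) eq
  ... | yes n≤i = <-irrefl (sym eq) (≤-<-trans
        (+-mono-≤ (*-monoˡ-≤ m n≤i) (*-monoʳ-≤ 2 (≤-trans j′≤4n (*-monoʳ-≤ 4 n≤i))))
        (+-monoʳ-< (i * m) (*-monoʳ-< 2 4i<j)))

  Gap⇒¬InS : ∀ {x} → Gap m x → ¬ InS m x
  Gap⇒¬InS (below s refl x<m) (inS n j x≡ _ _)   = odd<m⇒≢nm+2j {s = s} n j x<m x≡
  Gap⇒¬InS (exceptional x≡m+4) x∈                  = InS.x≢m+4 x∈ x≡m+4
  Gap⇒¬InS (block i j 4i<j j<m refl) (inS n j′ x≡ j′≤ _) = block≢ i j n j′ 4i<j j<m j′≤ x≡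

  odd<m⇔ : ∀ s → suc (2 * s) < m ⇔ s < h
  odd<m⇔ s = mk⇔
    (λ lt → *-cancelˡ-< 2 s h (≤-pred (subst (suc (2 * s) <_) m≡1+2h lt)))
    (λ s<h → subst (suc (2 * s) <_) (sym m≡1+2h) (s≤s (*-monoʳ-< 2 s<h)))

  m+odd≡2[1+h+s] : ∀ s → m + suc (2 * s) ≡ 2 * suc (h + s)
  m+odd≡2[1+h+s] s = trans (cong (λ z → z + suc (2 * s)) m≡1+2h) (regroup h s)
    where
    regroup : ∀ h s → suc (2 * h) + suc (2 * s) ≡ 2 * suc (h + s)
    regroup = solve-∀

  1+h+s<m : ∀ s → suc (2 * s) < m → suc (h + s) < m
  1+h+s<m s lt = subst (suc (h + s) <_) (sym m≡1+2h)
    (s≤s (<-≤-trans (+-monoʳ-< h (to (odd<m⇔ s) lt)) (≤-reflexive (cong (_+_ h) (sym (+-identityʳ h))))))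

  m+odd-Gap : ∀ s → suc (2 * s) < m → Gap m (suc (2 * s) + m)
  m+odd-Gap s lt =
    block 0 (suc (h + s)) (s≤s z≤n) (1+h+s<m s lt) (trans (+-comm (suc (2 * s)) m) (m+odd≡2[1+h+s] s))

  canonical-<m : ∀ {r} → r < m → Canonical m r
  canonical-<m {r} r<m with even⊎odd r
  ... | inj₁ (s , r≡2s)  = form 0 s (≤-<-trans (subst (s ≤_) (sym r≡2s) (m≤m+n s (1 * s))) r<m) r≡2s
  ... | inj₂ (s , r≡odd) = below s r≡odd r<m

  canonical-m+ : ∀ {y} → Canonical m y → Canonical m (m + y)
  canonical-m+ (below s refl y<m) = form 0 (suc (h + s)) (1+h+s<m s y<m) (m+odd≡2[1+h+s] s)
  canonical-m+ (form i j j<m refl) = form (suc i) j j<m (sym (+-assoc m (i * m) (2 * j)))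

  private instance
    m-nonZero : NonZero m
    m-nonZero = ≢-nonZero (λ m≡0 → 0≢1+n (trans (sym m≡0) m≡1+2h))

  canonical : ∀ x → Canonical m x
  canonical x = subst (Canonical m) (sym (m≡m%n+[m/n]*n x m)) (fromDivision (x / m) (m%n<n x m))
    where
    swap : ∀ a b c → a + (b + c) ≡ b + (a + c)
    swap a b c = trans (sym (+-assoc a b c)) (trans (cong (λ z → z + c) (+-comm a b)) (+-assoc b a c))
    fromDivision : ∀ q {r} → r < m → Canonical m (r + q * m)
    fromDivision zero    {r} r<m = subst (Canonical m) (sym (+-identityʳ r)) (canonical-<m r<m)
    fromDivision (suc q) {r} r<m =
      subst (Canonical m) (swap m r (q * m)) (canonical-m+ (fromDivision q r<m))

  InS⊎Gap : ∀ x → InS m x ⊎ Gap m x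
  InS⊎Gap x with canonical x
  ... | below s x≡ x<m = inj₂ (below s x≡ x<m)
  ... | form i j j<m x≡ with j ≤? 4 * i | x ≟ m + 4
  ...   | yes j≤4i | no x≢m+4  = inj₁ (inS i j x≡ j≤4i x≢m+4)
  ...   | yes _    | yes x≡m+4 = inj₂ (exceptional x≡m+4)
  ...   | no j≰4i  | _         = inj₂ (block i j (≰⇒> j≰4i) j<m x≡)

  rows-unique : ∀ i c → 4 * (i + c) < m → Unique (rows m i c)
  rows-unique i zero    _         = []
  rows-unique i (suc c) 4[i+c]<m  =
    Unique.++⁺ (row-unique m i (4 * suc c))
      (rows-unique (suc i) c (subst (λ z → 4 * z < m) (+-suc i c) 4[i+c]<m)) disjoint
    where
    disjoint : Disjoint (row m i (4 * suc c)) (rows m (suc i) c)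
    disjoint (x∈row , x∈rows) with j , _ , j≤ , refl ← ∈row⁻ m i (4 * suc c) x∈row
                                 | _ , j′ , i<i′ , _ , _ , x≡ ← ∈rows⁻ m (suc i) c x∈rows =
      canonical-≢ j′ (≤-<-trans j≤ (subst (_< m) (*-distribˡ-+ 4 i (suc c)) 4[i+c]<m)) i<i′ x≡

-- The case m = 4k + 5

S : ℕ → List ℕ
S k = 4 * k + 5 ∷ 4 * k + 7 ∷ 4 * k + 11 ∷ 4 * k + 13 ∷ []

odds : ℕ → List ℕ
odds h = applyUpTo (λ s → suc (2 * s)) h

gapList : ℕ → List ℕ
gapList k = odds (2 * k + 2) ++ 4 * k + 5 + 4 ∷ rows (4 * k + 5) 0 (suc k)

frobenius : ℕ → ℕ
frobenius k = k * (4 * k + 5) + 2 * (4 * suc k)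

pseudoFrobenius : ℕ → List ℕ
pseudoFrobenius k = 4 * k + 5 + 4 ∷ row (4 * k + 5) k 4

pseudoFrobeniusNumbers : ℕ → List ℤ
pseudoFrobeniusNumbers k =
  + (4 * k + 9) ∷ + (4 * k * k + 13 * k + 2) ∷ + (4 * k * k + 13 * k + 4) ∷
  + (4 * k * k + 13 * k + 6) ∷ + (4 * k * k + 13 * k + 8) ∷ []

4k+5≡1+2[2k+2] : ∀ k → 4 * k + 5 ≡ suc (2 * (2 * k + 2))
4k+5≡1+2[2k+2] = solve-∀

4k+5≡1+4[1+k] : ∀ k → 4 * k + 5 ≡ suc (4 * suc k)
4k+5≡1+4[1+k] = solve-∀

4k+7≡2+[4k+5] : ∀ k → 4 * k + 7 ≡ 2 + (4 * k + 5)
4k+7≡2+[4k+5] = solve-∀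

4k+4≡4[1+k] : ∀ k → 4 * k + 4 ≡ 4 * suc k
4k+4≡4[1+k] k = trans (+-comm (4 * k) 4) (sym (*-suc 4 k))

4k+9≤frobenius : ∀ {k} → 1 ≤ k → 4 * k + 5 + 4 ≤ frobenius k
4k+9≤frobenius {suc k} _ = subst (4 * suc k + 5 + 4 ≤_) (regroup k) (m≤m+n (4 * suc k + 5 + 4) (4 * k * k + 17 * k + 12))
  where
  regroup : ∀ k → 4 * suc k + 5 + 4 + (4 * k * k + 17 * k + 12) ≡ suc k * (4 * suc k + 5) + 2 * (4 * suc (suc k))
  regroup = solve-∀

frobenius<row+m : ∀ {k j s} → 1 ≤ k → 4 * k < j → 4 * k + 5 ≤ s → frobenius k < k * (4 * k + 5) + 2 * j + s
frobenius<row+m {suc k} {j} {s} _ 4k<j m≤s = ≤-trans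
  (subst (suc (frobenius (suc k)) ≤_) (regroup k) (m≤m+n (suc (frobenius (suc k))) (4 * k + 2)))
  (+-mono-≤ (+-monoʳ-≤ (suc k * (4 * suc k + 5)) (*-monoʳ-≤ 2 4k<j)) m≤s)
  where
  regroup : ∀ k → suc (suc k * (4 * suc k + 5) + 2 * (4 * suc (suc k))) + (4 * k + 2)
                  ≡ suc k * (4 * suc k + 5) + 2 * suc (4 * suc k) + (4 * suc k + 5)
  regroup = solve-∀

frobenius≡ : ∀ k → k * (4 * k + 5) + 2 * (4 * suc k) ≡ 4 * k * k + 13 * k + 8
frobenius≡ = solve-∀

rowEntry≡ : ∀ k u → k * (4 * k + 5) + 2 * suc (4 * k + u) ≡ 4 * k * k + 13 * k + 2 * suc u
rowEntry≡ = solve-∀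

pseudoFrobeniusNumbers≡ : ∀ k → map +_ (pseudoFrobenius k) ≡ pseudoFrobeniusNumbers k
pseudoFrobeniusNumbers≡ k =
  cong₂ _∷_ (cong +_ (+-assoc (4 * k) 5 4)) (cong₂ _∷_ (cong +_ (rowEntry≡ k 0))
    (cong₂ _∷_ (cong +_ (rowEntry≡ k 1)) (cong₂ _∷_ (cong +_ (rowEntry≡ k 2))
      (cong₂ _∷_ (cong +_ (rowEntry≡ k 3)) refl))))

module _ (k : ℕ) where

  open OddMultiplicity {h = 2 * k + 2} (4k+5≡1+2[2k+2] k)

  <m⇔≤4[1+k] : ∀ {j} → j < 4 * k + 5 ⇔ j ≤ 4 * suc k
  <m⇔≤4[1+k] {j} = mk⇔ (λ j<m → ≤-pred (subst (j <_) (4k+5≡1+4[1+k] k) j<m))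
                       (λ j≤ → subst (j <_) (sym (4k+5≡1+4[1+k] k)) (s≤s j≤))

  gens≡S : gens (4 * k + 5) ≡ S k
  gens≡S = cong₂ _∷_ (+-identityʳ (4 * k + 5)) (cong₂ _∷_ (+-assoc (4 * k) 5 2)
             (cong₂ _∷_ (+-assoc (4 * k) 5 6) (cong₂ _∷_ (+-assoc (4 * k) 5 8) refl)))

  ∈S⇔InS : ∀ {x} → x ∈⟨ S k ⟩ ⇔ InS (4 * k + 5) x
  ∈S⇔InS {x} = subst (λ gs → x ∈⟨ gs ⟩ ⇔ InS (4 * k + 5) x) gens≡S (∈⟨gens⟩⇔InS (m≤n+m 5 (4 * k)))

  ∉S⇔Gap : ∀ {x} → (¬ x ∈⟨ S k ⟩) ⇔ Gap (4 * k + 5) x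
  ∉S⇔Gap {x} = mk⇔ classify (λ gap → Gap⇒¬InS gap ∘ to ∈S⇔InS)
    where
    classify : ¬ x ∈⟨ S k ⟩ → Gap (4 * k + 5) x
    classify x∉ with InS⊎Gap x
    ... | inj₁ x∈  = ⊥-elim (x∉ (from ∈S⇔InS x∈))
    ... | inj₂ gap = gap

  generator≢0 : ∀ {g} → g ∈ S k → g ≢ 0
  generator≢0 (here refl)                         = m+1+n≢0 (4 * k)
  generator≢0 (there (here refl))                 = m+1+n≢0 (4 * k)
  generator≢0 (there (there (here refl)))         = m+1+n≢0 (4 * k)
  generator≢0 (there (there (there (here refl)))) = m+1+n≢0 (4 * k)

  PF+generator∉Gap : ∀ {x g} → IsPF (S k) (+ x) → g ∈ S k → ¬ Gap (4 * k + 5) (x + g)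
  PF+generator∉Gap pf g∈ gap =
    from ∉S⇔Gap gap (proj₂ (to IsPF[+x]⇔ pf) _ (∈⟨⟩-gen g∈) (generator≢0 g∈))

  ∈S⇒≥m : ∀ {s} → s ∈⟨ S k ⟩ → s ≢ 0 → 4 * k + 5 ≤ s
  ∈S⇒≥m s∈ s≢0 with InS⇒≡0⊎≥m (to ∈S⇔InS s∈)
  ... | inj₁ s≡0 = ⊥-elim (s≢0 s≡0)
  ... | inj₂ m≤s = m≤s

  m+4≢block : ∀ i j → 4 * i < j → j < 4 * k + 5 → 4 * k + 5 + 4 ≢ i * (4 * k + 5) + 2 * j
  m+4≢block i j 4i<j j<m eq =
    block≢ i j 1 2 4i<j j<m (s≤s (s≤s z≤n)) (trans (sym eq) (cong (λ z → z + 4) (sym (*-identityˡ (4 * k + 5)))))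

  Gap⇒≤frobenius : 1 ≤ k → ∀ {x} → Gap (4 * k + 5) x → x ≤ frobenius k
  Gap⇒≤frobenius 1≤k (below _ _ x<m)         = ≤-trans (<⇒≤ x<m) (≤-trans (m≤m+n _ 4) (4k+9≤frobenius 1≤k))
  Gap⇒≤frobenius 1≤k (exceptional refl)      = 4k+9≤frobenius 1≤k
  Gap⇒≤frobenius _   (block i j 4i<j j<m refl) =
    +-mono-≤ (*-monoˡ-≤ (4 * k + 5) (≤-pred (*-cancelˡ-< 4 i (suc k) (<-≤-trans 4i<j j≤)))) (*-monoʳ-≤ 2 j≤)
    where
    j≤ : j ≤ 4 * suc k
    j≤ = to <m⇔≤4[1+k] j<m

  frobenius-Gap : Gap (4 * k + 5) (frobenius k)
  frobenius-Gap = block k (4 * suc k) (*-monoʳ-< 4 (n<1+n k)) (from <m⇔≤4[1+k] ≤-refl) refl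

  >frobenius⇒∈S : 1 ≤ k → ∀ {x} → frobenius k < x → x ∈⟨ S k ⟩
  >frobenius⇒∈S 1≤k {x} F<x with InS⊎Gap x
  ... | inj₁ x∈  = from ∈S⇔InS x∈
  ... | inj₂ gap = ⊥-elim (<⇒≱ F<x (Gap⇒≤frobenius 1≤k gap))

  isFrobenius : 1 ≤ k → IsFrobenius (S k) (+ frobenius k)
  isFrobenius 1≤k = from ∉S⇔Gap frobenius-Gap ∘ to +∈ℤ⟨⟩⇔∈⟨⟩ , bound
    where
    bound : ∀ x → ¬ x ∈ℤ⟨ S k ⟩ → x ℤ.≤ + frobenius k
    bound (+ n)    n∉ = ℤ.+≤+ (Gap⇒≤frobenius 1≤k (to ∉S⇔Gap (n∉ ∘ from +∈ℤ⟨⟩⇔∈⟨⟩)))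
    bound -[1+ n ] _  = ℤ.-≤+

  ∈gapList⇔Gap : ∀ {x} → x ∈ gapList k ⇔ Gap (4 * k + 5) x
  ∈gapList⇔Gap = mk⇔ toGap fromGap
    where
    toGap : ∀ {x} → x ∈ gapList k → Gap (4 * k + 5) x
    toGap x∈ with ∈-++⁻ (odds (2 * k + 2)) x∈
    ... | inj₁ x∈odds with s , s<h , refl ← ∈-applyUpTo⁻ (λ s → suc (2 * s)) x∈odds =
      below s refl (from (odd<m⇔ s) s<h)
    ... | inj₂ (here refl) = exceptional refl
    ... | inj₂ (there x∈rows) with i , j , _ , 4i<j , j≤ , refl ← ∈rows⁻ (4 * k + 5) 0 (suc k) x∈rows =
      block i j 4i<j (from <m⇔≤4[1+k] j≤) refl
    fromGap : ∀ {x} → Gap (4 * k + 5) x → x ∈ gapList k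
    fromGap (below s refl x<m) = ∈-++⁺ˡ (∈-applyUpTo⁺ (λ s → suc (2 * s)) (to (odd<m⇔ s) x<m))
    fromGap (exceptional refl) = ∈-++⁺ʳ (odds (2 * k + 2)) (here refl)
    fromGap (block i j 4i<j j<m refl) = ∈-++⁺ʳ (odds (2 * k + 2))
      (there (∈rows⁺ (4 * k + 5) 0 (suc k) i z≤n 4i<j (to <m⇔≤4[1+k] j<m)))

  gapList-unique : Unique (gapList k)
  gapList-unique = Unique.++⁺ odds-unique
    (All.tabulate m+4∉rows ∷ rows-unique 0 (suc k) (from <m⇔≤4[1+k] ≤-refl)) odds-disjoint
    where
    odds-unique : Unique (odds (2 * k + 2))
    odds-unique = Unique.applyUpTo⁺₁ (λ s → suc (2 * s)) (2 * k + 2) (λ s<s′ _ → <⇒≢ (s≤s (*-monoʳ-< 2 s<s′)))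
    m+4∉rows : ∀ {x} → x ∈ rows (4 * k + 5) 0 (suc k) → 4 * k + 5 + 4 ≢ x
    m+4∉rows x∈ with i , j , _ , 4i<j , j≤ , refl ← ∈rows⁻ (4 * k + 5) 0 (suc k) x∈ =
      m+4≢block i j 4i<j (from <m⇔≤4[1+k] j≤)
    odd∉rest : ∀ {s} → s < 2 * k + 2 → ¬ suc (2 * s) ∈ 4 * k + 5 + 4 ∷ rows (4 * k + 5) 0 (suc k)
    odd∉rest {s} s<h (here eq) = odd<m⇒≢nm+2j {s = s} 1 2 (from (odd<m⇔ s) s<h)
                                   (trans eq (cong (λ z → z + 4) (sym (*-identityˡ (4 * k + 5)))))
    odd∉rest {s} s<h (there x∈rows) with i , j , _ , _ , _ , x≡ ← ∈rows⁻ (4 * k + 5) 0 (suc k) x∈rows =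
      odd<m⇒≢nm+2j {s = s} i j (from (odd<m⇔ s) s<h) x≡
    odds-disjoint : Disjoint (odds (2 * k + 2)) (4 * k + 5 + 4 ∷ rows (4 * k + 5) 0 (suc k))
    odds-disjoint (x∈odds , x∈rest) with s , s<h , refl ← ∈-applyUpTo⁻ (λ s → suc (2 * s)) x∈odds =
      odd∉rest s<h x∈rest

  length-gapList : length (gapList k) ≡ 2 * k * k + 8 * k + 7
  length-gapList = begin
    length (gapList k)
      ≡⟨ length-++ (odds (2 * k + 2)) ⟩
    length (odds (2 * k + 2)) + suc (length (rows (4 * k + 5) 0 (suc k)))
      ≡⟨ cong₂ _+_ (length-applyUpTo _ (2 * k + 2)) (cong suc (length-rows (4 * k + 5) 0 (suc k))) ⟩
    2 * k + 2 + suc (2 * suc k * suc (suc k))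
      ≡⟨ regroup k ⟩
    2 * k * k + 8 * k + 7 ∎
    where
    open ≡-Reasoning
    regroup : ∀ k → 2 * k + 2 + suc (2 * suc k * suc (suc k)) ≡ 2 * k * k + 8 * k + 7
    regroup = solve-∀

  isGenus : IsGenus (S k) (2 * k * k + 8 * k + 7)
  isGenus = gapList k , gapList-unique , (λ _ → ⇔.trans ∈gapList⇔Gap (⇔.sym ∉S⇔Gap)) , length-gapList

  m+4-PF : IsPF (S k) (+ (4 * k + 5 + 4))
  m+4-PF = from IsPF[+x]⇔
    (from ∉S⇔Gap (exceptional refl) , λ s s∈ s≢0 → from ∈S⇔InS (m+4+InS (to ∈S⇔InS s∈) s≢0))

  lastRow-PF : 1 ≤ k → ∀ {x} → x ∈ row (4 * k + 5) k 4 → IsPF (S k) (+ x)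
  lastRow-PF 1≤k x∈ with j , 4k<j , j≤ , refl ← ∈row⁻ (4 * k + 5) k 4 x∈ = from IsPF[+x]⇔
    (from ∉S⇔Gap (block k j 4k<j (from <m⇔≤4[1+k] (subst (j ≤_) (4k+4≡4[1+k] k) j≤)) refl) ,
     λ s s∈ s≢0 → >frobenius⇒∈S 1≤k (frobenius<row+m 1≤k 4k<j (∈S⇒≥m s∈ s≢0)))

  negative-¬PF : ∀ p → ¬ IsPF (S k) -[1+ p ]
  negative-¬PF p (_ , closed)
    with n , eq , n∈ ← closed (4 * k + 5) (∈⟨⟩-gen (here refl)) (generator≢0 (here refl))
       | n′ , eq′ , n′∈ ← closed (4 * k + 7) (∈⟨⟩-gen (there (here refl))) (generator≢0 (there (here refl)))
    with InS⇒≡0⊎≥m (to ∈S⇔InS n∈)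
  ... | inj₂ m≤n = <-irrefl refl (<-≤-trans (subst (n <_) (-[1+p]+g≡+n⇒n+1+p≡g eq) (m<m+n n (s≤s z≤n))) m≤n)
  ... | inj₁ refl = from ∉S⇔Gap (block 0 1 (s≤s z≤n) (from <m⇔≤4[1+k] (s≤s z≤n)) refl) (subst (_∈⟨ S k ⟩) n′≡2 n′∈)
    where
    n′≡2 : n′ ≡ 2
    n′≡2 = +-cancelʳ-≡ (suc p) n′ 2 (trans (-[1+p]+g≡+n⇒n+1+p≡g eq′)
             (trans (4k+7≡2+[4k+5] k) (cong (_+_ 2) (sym (-[1+p]+g≡+n⇒n+1+p≡g eq)))))

  innerRow-¬PF : ∀ {i j} → i < k → 4 * i < j → j ≤ 4 * suc k → ¬ IsPF (S k) (+ (i * (4 * k + 5) + 2 * j))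
  innerRow-¬PF {i} {j} i<k 4i<j j≤ pf with j + 4 ≤? 4 * suc k
  ... | yes j+4≤ = PF+generator∉Gap pf (there (there (there (here refl))))
    (block (suc i) (j + 4) 4[1+i]<j+4 (from <m⇔≤4[1+k] j+4≤) (add-m+8 k i j))
    where
    4[1+i]<j+4 : 4 * suc i < j + 4
    4[1+i]<j+4 = subst (_< j + 4) (4k+4≡4[1+k] i) (+-monoˡ-< 4 4i<j)
    add-m+8 : ∀ k i j → i * (4 * k + 5) + 2 * j + (4 * k + 13) ≡ suc i * (4 * k + 5) + 2 * (j + 4)
    add-m+8 = solve-∀
  ... | no j+4≰ = PF+generator∉Gap pf (here refl)
    (block (suc i) j 4[1+i]<j (from <m⇔≤4[1+k] j≤)
      (trans (+-comm _ (4 * k + 5)) (sym (+-assoc (4 * k + 5) (i * (4 * k + 5)) (2 * j)))))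
    where
    4[1+i]<j : 4 * suc i < j
    4[1+i]<j = ≤-<-trans (*-monoʳ-≤ 4 i<k)
                 (+-cancelʳ-< 4 (4 * k) j (subst (_< j + 4) (sym (4k+4≡4[1+k] k)) (≰⇒> j+4≰)))

  PF⇒∈ : ∀ {x} → IsPF (S k) x → x ∈ map +_ (pseudoFrobenius k)
  PF⇒∈ { -[1+ p ]} pf = ⊥-elim (negative-¬PF p pf)
  PF⇒∈ {+ x} pf with to ∉S⇔Gap (proj₁ (to IsPF[+x]⇔ pf))
  ... | below s refl x<m = ⊥-elim (PF+generator∉Gap pf (here refl) (m+odd-Gap s x<m))
  ... | exceptional refl = here refl
  ... | block i j 4i<j j<m refl with i ≟ k
  ...   | yes refl = there (∈-map⁺ +_ (∈row⁺ (4 * k + 5) k 4 4i<j (subst (j ≤_) (sym (4k+4≡4[1+k] k)) (to <m⇔≤4[1+k] j<m))))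
  ...   | no i≢k = ⊥-elim (innerRow-¬PF (≤∧≢⇒< i≤k i≢k) 4i<j (to <m⇔≤4[1+k] j<m) pf)
    where
    i≤k : i ≤ k
    i≤k = ≤-pred (*-cancelˡ-< 4 i (suc k) (<-≤-trans 4i<j (to <m⇔≤4[1+k] j<m)))

  ∈⇒PF : 1 ≤ k → ∀ {x} → x ∈ map +_ (pseudoFrobenius k) → IsPF (S k) x
  ∈⇒PF _   (here refl) = m+4-PF
  ∈⇒PF 1≤k (there x∈) with y , y∈ , refl ← ∈-map⁻ +_ x∈ = lastRow-PF 1≤k y∈

  IsPF⇔ : 1 ≤ k → ∀ {x} → IsPF (S k) x ⇔ x ∈ pseudoFrobeniusNumbers k
  IsPF⇔ 1≤k {x} = subst (λ L → IsPF (S k) x ⇔ x ∈ L) (pseudoFrobeniusNumbers≡ k) (mk⇔ PF⇒∈ (∈⇒PF 1≤k))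

  pseudoFrobenius-unique : Unique (map +_ (pseudoFrobenius k))
  pseudoFrobenius-unique = Unique.map⁺ ℤP.+-injective (All.tabulate m+4∉lastRow ∷ row-unique (4 * k + 5) k 4)
    where
    m+4∉lastRow : ∀ {x} → x ∈ row (4 * k + 5) k 4 → 4 * k + 5 + 4 ≢ x
    m+4∉lastRow x∈ with j , 4k<j , j≤ , refl ← ∈row⁻ (4 * k + 5) k 4 x∈ =
      m+4≢block k j 4k<j (from <m⇔≤4[1+k] (subst (j ≤_) (4k+4≡4[1+k] k) j≤))

  isType : 1 ≤ k → IsType (S k) 5
  isType 1≤k = pseudoFrobeniusNumbers k , subst Unique (pseudoFrobeniusNumbers≡ k) pseudoFrobenius-unique ,
               (λ _ → ⇔.sym (IsPF⇔ 1≤k)) , refl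

corollary26 : (k : ℕ) → 1 ≤ k →
    let S = (4 * k + 5) ∷ (4 * k + 7) ∷ (4 * k + 11) ∷ (4 * k + 13) ∷ [] in
    (∀ x → IsPF S x ⇔ (x ∈ (+ (4 * k + 9) ∷ + (4 * k * k + 13 * k + 2) ∷ + (4 * k * k + 13 * k + 4) ∷ + (4 * k * k + 13 * k + 6) ∷ + (4 * k * k + 13 * k + 8) ∷ [])))
    × IsFrobenius S (+ (4 * k * k + 13 * k + 8))
    × IsGenus S (2 * k * k + 8 * k + 7)
    × IsType S 5
corollary26 k 1≤k =
  (λ _ → IsPF⇔ k 1≤k) ,
  subst (λ F → IsFrobenius (S k) (+ F)) (frobenius≡ k) (isFrobenius k 1≤k) ,
  isGenus k ,
  isType k 1≤k
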